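{- Let $X$ be a finite alphabet and let $C=(v_1,\ldots,v_m)$ be a sequence of non-empty words over $X$. Suppose there exist $1\leq \mu,\kappa\leq m$ with $\mu\neq\kappa$ and a word $v\in X^*$ such that $v_\mu=v_\kappa v$. Define $C'=(v'_1,\ldots,v'_m)$ by $v'_i=v_i$ for $i\neq\mu$ and $v'_\mu=v$. If $C$ is not a code, then $C'$ is not a code.
   Context: $X^*$ denotes the set of all words (including the empty word) over $X$. A code over $X$ is a finite sequence $(u_1,\ldots,u_m)$ of words over $X$ such that every $w\in X^*$ has at most one factorization into its terms: if $w=u_{i_1}\cdots u_{i_l}=u_{j_1}\cdots u_{j_{l'}}$ with $l,l'\geq 1$ and indices in $\{1,\ldots,m\}$, then $l=l'$ and $i_t=j_t$ for all $t$. -}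

module Defs where

open import Data.Nat using (ℕ)
open import Data.Fin using (Fin)
open import Data.List using (List; []; _∷_; _++_; concat; map)
open import Relation.Binary.PropositionalEquality using (_≡_)
open import Data.Empty using (⊥)
open import Data.Unit using (⊤)

Word : Set → Set
Word X = List X

flatten : {X : Set} {m : ℕ} → (Fin m → Word X) → List (Fin m) → Word X
flatten u is = concat (map u is)

NonEmpty : {A : Set} → List A → Set
NonEmpty [] = ⊥
NonEmpty (_ ∷ _) = ⊤

IsCode : {X : Set} {m : ℕ} → (Fin m → Word X) → Set
IsCode {X} {m} u =
  (is js : List (Fin m)) → NonEmpty is → NonEmpty js →
  flatten u is ≡ flatten u js → is ≡ js

-- Replacing every index μ by the pair κ μ turns a factorization
-- over C into one of the same word over C'. This substitution is injective on index
-- lists (no image starts with μ, since μ ≠ κ), so two distinct factorizations over C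
-- become two distinct factorizations over C'. The words v_i need not be non-empty.
module Submission where

open import Defs
open import Data.Nat using (ℕ)
open import Data.Fin using (Fin)
open import Data.Fin.Properties using (_≟_)
open import Data.List using (List; []; _∷_; _++_; concatMap)
open import Data.List.Properties using (++-assoc; ∷-injective)
open import Data.Product using (_,_; proj₁; proj₂)
open import Data.Unit using (tt)
open import Function using (_∘_)
open import Function.Definitions using (Injective)
open import Relation.Binary.PropositionalEquality
open import Relation.Nullary using (¬_; yes; no; contradiction)

IsCode-reindex : {X : Set} {m n : ℕ} (C : Fin m → Word X) (D : Fin n → Word X)
  (σ : List (Fin m) → List (Fin n)) →
  Injective _≡_ _≡_ σ → (∀ is → NonEmpty is → NonEmpty (σ is)) →
  (∀ is → flatten D (σ is) ≡ flatten C is) →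
  IsCode D → IsCode C
IsCode-reindex C D σ σ-injective σ-nonEmpty σ-flatten codeD is js nis njs eq =
  σ-injective (codeD (σ is) (σ js) (σ-nonEmpty is nis) (σ-nonEmpty js njs)
    (trans (σ-flatten is) (trans eq (sym (σ-flatten js)))))

module Splitting {m : ℕ} (μ κ : Fin m) where

  splitIndex : Fin m → List (Fin m)
  splitIndex i with i ≟ μ
  ... | yes _ = κ ∷ μ ∷ []
  ... | no _ = i ∷ []

  split : List (Fin m) → List (Fin m)
  split = concatMap splitIndex

  split-nonEmpty : ∀ is → NonEmpty is → NonEmpty (split is)
  split-nonEmpty (i ∷ is) _ with i ≟ μ
  ... | yes _ = tt
  ... | no _ = tt

  module _ {X : Set} (C C' : Fin m → Word X) (v : Word X) (Cμ : C μ ≡ C κ ++ v)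
    (C'κ : C' κ ≡ C κ) (C'μ : C' μ ≡ v) (C'i : (i : Fin m) → i ≢ μ → C' i ≡ C i) where

    split-flatten : ∀ is → flatten C' (split is) ≡ flatten C is
    split-flatten [] = refl
    split-flatten (i ∷ is) with i ≟ μ
    ... | yes refl = begin
        C' κ ++ C' μ ++ flatten C' (split is)  ≡⟨ cong₂ _++_ C'κ (cong₂ _++_ C'μ (split-flatten is)) ⟩
        C κ ++ v ++ flatten C is               ≡⟨ ++-assoc (C κ) v (flatten C is) ⟨
        (C κ ++ v) ++ flatten C is             ≡⟨ cong (_++ flatten C is) Cμ ⟨
        C μ ++ flatten C is                    ∎
      where open ≡-Reasoning
    ... | no i≢μ = cong₂ _++_ (C'i i i≢μ) (split-flatten is)

  module _ (μ≢κ : μ ≢ κ) where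

    split-head≢μ : ∀ is ys → split is ≢ μ ∷ ys
    split-head≢μ (i ∷ is) ys eq with i ≟ μ
    ... | yes _ = μ≢κ (sym (proj₁ (∷-injective eq)))
    ... | no i≢μ = i≢μ (proj₁ (∷-injective eq))

    split-injective : Injective _≡_ _≡_ split
    split-injective {[]} {[]} _ = refl
    split-injective {[]} {j ∷ js} eq with j ≟ μ
    split-injective {[]} {j ∷ js} () | yes _
    split-injective {[]} {j ∷ js} () | no _
    split-injective {i ∷ is} {[]} eq with i ≟ μ
    split-injective {i ∷ is} {[]} () | yes _
    split-injective {i ∷ is} {[]} () | no _
    split-injective {i ∷ is} {j ∷ js} eq with i ≟ μ | j ≟ μ
    ... | yes refl | yes refl = cong (μ ∷_) (split-injective (proj₂ (∷-injective (proj₂ (∷-injective eq)))))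
    ... | yes _ | no _ = contradiction (sym (proj₂ (∷-injective eq))) (split-head≢μ js (split is))
    ... | no _ | yes _ = contradiction (proj₂ (∷-injective eq)) (split-head≢μ is (split js))
    ... | no _ | no _ with ∷-injective eq
    ...   | refl , eq′ = cong (i ∷_) (split-injective eq′)

lemma1 : (k m : ℕ) (C C' : Fin m → Word (Fin k)) →
    ((i : Fin m) → NonEmpty (C i)) →
    (μ κ : Fin m) (v : Word (Fin k)) → μ ≢ κ →
    C μ ≡ C κ ++ v →
    ((i : Fin m) → i ≢ μ → C' i ≡ C i) → C' μ ≡ v →
    ¬ IsCode C → ¬ IsCode C'
lemma1 k m C C' _ μ κ v μ≢κ Cμ C'i C'μ notCodeC codeC' =
  notCodeC (IsCode-reindex C C' split (split-injective μ≢κ) split-nonEmpty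
    (split-flatten C C' v Cμ (C'i κ (μ≢κ ∘ sym)) C'μ C'i) codeC')
  where
  open Splitting μ κ
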